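{- Let $\beta\in\mathbb{Q}$ with $0<\beta<1$ be a fixed constant, and let $p_1,\dots,p_{n-1}$ be positive integers. Let $S_n$ be the star with centre $0$ and leaves $1,\dots,n-1$, with distribution $\pi_0=1-\beta$ and $\pi_i=\beta\frac{p_i}{\sum_j p_j}$ for $i\ge1$. Then the multiset $\{p_1,\dots,p_{n-1}\}$ can be partitioned into two subsets of equal sum if and only if $\mathfrak{C}(S_n,\pi)=\beta$; otherwise $\mathfrak{C}(S_n,\pi)<\beta-\Omega_\beta\!\left(\frac{1}{(\sum_i p_i)^2}\right)$.
   Context: $\mathfrak{C}(G,\pi)=\sup_f\mathrm{Var}_\pi(f)$ over all $f:V\to\mathbb{R}$ with $|f(u)-f(v)|\le1$ for every edge $\{u,v\}$, where $\mathrm{Var}_\pi$ is the variance under $\pi$. $\Omega_\beta$ hides a positive constant depending only on $\beta$.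
   Formalization: The test functions f in the supremum defining $\mathfrak{C}(S_n,\pi)$ take values in ℚ rather than ℝ. -}

module Defs where

open import Data.Nat as ℕ using (ℕ; zero; suc)
open import Data.Integer using (+_)
open import Data.Rational using (ℚ; 0ℚ; 1ℚ; _+_; _*_; _-_; ∣_∣; _≤_; _<_; _/_)
open import Data.Fin using (Fin; zero; suc)
open import Data.Bool using (Bool; true; false)
open import Data.Product using (Σ; _×_; ∃)
open import Relation.Binary.PropositionalEquality using (_≡_)

Σℚ : ∀ {n} → (Fin n → ℚ) → ℚ
Σℚ {zero}  f = 0ℚ
Σℚ {suc n} f = f zero + Σℚ (λ i → f (suc i))

Σℕ : ∀ {n} → (Fin n → ℕ) → ℕ
Σℕ {zero}  f = 0
Σℕ {suc n} f = f zero ℕ.+ Σℕ (λ i → f (suc i))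

-- a / b as a rational (b = 0 gives 0; only used with b > 0)
divℕ : ℕ → ℕ → ℚ
divℕ a zero    = 0ℚ
divℕ a (suc b) = (+ a) / suc b

-- The star S_n, n = k + 2: vertex 0 = centre, vertex (suc i) = leaf i+1.
-- Edges are exactly {0, suc i}.  f is 1-Lipschitz iff |f 0 - f (suc i)| ≤ 1.
Lipschitz : ∀ {k} → (Fin (suc (suc k)) → ℚ) → Set
Lipschitz {k} f = (i : Fin (suc k)) → ∣ f zero - f (suc i) ∣ ≤ 1ℚ

total : ∀ {k} → (Fin (suc k) → ℕ) → ℕ
total p = Σℕ p

πstar : ∀ {k} → ℚ → (Fin (suc k) → ℕ) → Fin (suc (suc k)) → ℚ
πstar β p zero    = 1ℚ - β
πstar β p (suc i) = β * divℕ (p i) (total p)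

Var : ∀ {n} → (Fin n → ℚ) → (Fin n → ℚ) → ℚ
Var π f = Σℚ (λ v → π v * (f v * f v)) - (Σℚ (λ v → π v * f v) * Σℚ (λ v → π v * f v))

-- 𝔠(S_n, π) = x  (supremum of Var over 1-Lipschitz f equals x)
CEq : ∀ {k} → (Fin (suc (suc k)) → ℚ) → ℚ → Set
CEq {k} π x =
  ((f : Fin (suc (suc k)) → ℚ) → Lipschitz f → Var π f ≤ x)
  × ((ε : ℚ) → 0ℚ < ε → Σ (Fin (suc (suc k)) → ℚ) λ f → Lipschitz f × (x - ε < Var π f))

-- 𝔠(S_n, π) < x  (supremum strictly below x)
CLt : ∀ {k} → (Fin (suc (suc k)) → ℚ) → ℚ → Set
CLt {k} π x =
  Σ ℚ λ δ → 0ℚ < δ × ((f : Fin (suc (suc k)) → ℚ) → Lipschitz f → Var π f + δ ≤ x)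

-- multiset {p_1..p_{n-1}} splits into two parts of equal sum:
-- S assigns each index to part true or part false.
inPart : Bool → Bool → ℕ → ℕ
inPart true  true  a = a
inPart false false a = a
inPart _     _     a = 0

Partitionable : ∀ {k} → (Fin (suc k) → ℕ) → Set
Partitionable {k} p =
  Σ (Fin (suc k) → Bool) λ S →
    Σℕ (λ i → inPart true (S i) (p i)) ≡ Σℕ (λ i → inPart false (S i) (p i))

module Submission where

-- Proof idea.  Write P = Σ p_i and u = β/P, so that the star carries weight
-- π_0 = 1 - β at the centre and q_i = u p_i on leaf i, with Σ q_i = β.
--
-- (1) A variance is unchanged by adding a constant, so for 1-Lipschitz f we
--     measure f from the centre: with g_i = f(i) - f(0) we have |g_i| ≤ 1 and
--     Var_π f = Σ q_i g_i² - (Σ q_i g_i)².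
-- (2) Since g_i² ≤ |g_i|, this gives  Var_π f ≤ β - (u T + (u M)²)  where the
--     slack T = Σ p_i (1 - |g_i|) ≥ 0 and the net rise M = Σ p_i g_i.
-- (3) Rounding each g_i to its sign splits the p_i into two parts with sums
--     A and B, and moves M by at most T; hence |M| + T ≥ |A - B|.
-- (4) A balanced split (A = B) gives a ±1 function of variance exactly β.
--     If no split is balanced then |A - B| ≥ 1, so |M| + T ≥ 1, which forces
--     u T + (u M)² ≥ u²/4.  With δ = u²/8 = (β²/8)/P² every Lipschitz f then
--     has Var_π f + δ ≤ β - δ: this is both the converse and the gap, c = β²/8.

open import Defs
import Data.Nat
open import Data.Nat as ℕ using (ℕ; zero; suc)
import Data.Nat.Properties as ℕP
open import Data.Integer as ℤ using (+_)
import Data.Integer.Properties as ℤP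
open import Data.Rational
open import Data.Rational.Properties
open import Data.Rational.Solver
import Data.Rational.Unnormalised as ℚᵘ
import Data.Rational.Unnormalised.Properties as ℚᵘP
open import Data.Fin using (Fin; zero; suc)
open import Data.Bool using (Bool; true; false)
open import Data.Product using (Σ; _×_; _,_)
open import Data.Sum using (inj₁; inj₂)
open import Data.Empty using (⊥-elim)
open import Relation.Nullary using (¬_; Dec; yes; no; does)
open import Relation.Binary.PropositionalEquality
open import Relation.Binary.Definitions using (tri<; tri≈; tri>)

open +-*-Solver

-- Natural numbers as rationals.  All identities are checked on the
-- unnormalised representatives, where they become integer identities.

↑_ : ℕ → ℚ
↑ a = divℕ a 1

toℚᵘ-divℕ : ∀ a b → toℚᵘ (divℕ a (suc b)) ℚᵘ.≃ ℚᵘ.mkℚᵘ (+ a) b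
toℚᵘ-divℕ a b = toℚᵘ-fromℚᵘ (ℚᵘ.mkℚᵘ (+ a) b)

↑-+ : ∀ a b → ↑ (a ℕ.+ b) ≡ ↑ a + ↑ b
↑-+ a b = toℚᵘ-injective (begin
  toℚᵘ (↑ (a ℕ.+ b))                          ≈⟨ toℚᵘ-divℕ (a ℕ.+ b) 0 ⟩
  ℚᵘ.mkℚᵘ (+ (a ℕ.+ b)) 0                     ≈⟨ ℚᵘ.*≡* (cong (ℤ._* + 1) sum-of-units) ⟩
  ℚᵘ.mkℚᵘ (+ a) 0 ℚᵘ.+ ℚᵘ.mkℚᵘ (+ b) 0        ≈⟨ ℚᵘP.+-cong (toℚᵘ-divℕ a 0) (toℚᵘ-divℕ b 0) ⟨
  toℚᵘ (↑ a) ℚᵘ.+ toℚᵘ (↑ b)                  ≈⟨ toℚᵘ-homo-+ (↑ a) (↑ b) ⟨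
  toℚᵘ (↑ a + ↑ b)                            ∎)
  where
  open ℚᵘP.≃-Reasoning
  sum-of-units : + (a ℕ.+ b) ≡ + a ℤ.* + 1 ℤ.+ + b ℤ.* + 1
  sum-of-units = trans (ℤP.pos-+ a b) (sym (cong₂ ℤ._+_ (ℤP.*-identityʳ (+ a)) (ℤP.*-identityʳ (+ b))))

↑-divℕ : ∀ a {n} → 0 ℕ.< n → divℕ a n ≡ ↑ a * divℕ 1 n
↑-divℕ a {suc b} _ = toℚᵘ-injective (begin
  toℚᵘ (divℕ a (suc b))                       ≈⟨ toℚᵘ-divℕ a b ⟩
  ℚᵘ.mkℚᵘ (+ a) b                             ≈⟨ ℚᵘ.*≡* cross ⟩
  ℚᵘ.mkℚᵘ (+ a) 0 ℚᵘ.* ℚᵘ.mkℚᵘ (+ 1) b        ≈⟨ ℚᵘP.*-cong (toℚᵘ-divℕ a 0) (toℚᵘ-divℕ 1 b) ⟨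
  toℚᵘ (↑ a) ℚᵘ.* toℚᵘ (divℕ 1 (suc b))       ≈⟨ toℚᵘ-homo-* (↑ a) (divℕ 1 (suc b)) ⟨
  toℚᵘ (↑ a * divℕ 1 (suc b))                 ∎)
  where
  open ℚᵘP.≃-Reasoning
  cross : + a ℤ.* + (1 ℕ.* suc b) ≡ (+ a ℤ.* + 1) ℤ.* + suc b
  cross = trans (cong (λ d → + a ℤ.* + d) (ℕP.*-identityˡ (suc b)))
                (cong (ℤ._* + suc b) (sym (ℤP.*-identityʳ (+ a))))

↑-inverse : ∀ {n} → 0 ℕ.< n → ↑ n * divℕ 1 n ≡ 1ℚ
↑-inverse {suc b} _ = toℚᵘ-injective (begin
  toℚᵘ (↑ (suc b) * divℕ 1 (suc b))              ≈⟨ toℚᵘ-homo-* (↑ (suc b)) (divℕ 1 (suc b)) ⟩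
  toℚᵘ (↑ (suc b)) ℚᵘ.* toℚᵘ (divℕ 1 (suc b))    ≈⟨ ℚᵘP.*-cong (toℚᵘ-divℕ (suc b) 0) (toℚᵘ-divℕ 1 b) ⟩
  ℚᵘ.mkℚᵘ (+ suc b) 0 ℚᵘ.* ℚᵘ.mkℚᵘ (+ 1) b        ≈⟨ ℚᵘ.*≡* cross ⟩
  ℚᵘ.1ℚᵘ                                          ∎)
  where
  open ℚᵘP.≃-Reasoning
  cross : (+ suc b ℤ.* + 1) ℤ.* + 1 ≡ + 1 ℤ.* + (1 ℕ.* suc b)
  cross = trans (ℤP.*-identityʳ _) (trans (ℤP.*-identityʳ _)
            (trans (cong +_ (sym (ℕP.*-identityˡ (suc b)))) (sym (ℤP.*-identityˡ _))))

divℕ-square : ∀ {n} → 0 ℕ.< n → divℕ 1 (n ℕ.* n) ≡ divℕ 1 n * divℕ 1 n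
divℕ-square {suc b} _ = toℚᵘ-injective (begin
  toℚᵘ (divℕ 1 (suc b ℕ.* suc b))                      ≈⟨ toℚᵘ-divℕ 1 _ ⟩
  ℚᵘ.mkℚᵘ (+ 1) b ℚᵘ.* ℚᵘ.mkℚᵘ (+ 1) b                  ≈⟨ ℚᵘP.*-cong (toℚᵘ-divℕ 1 b) (toℚᵘ-divℕ 1 b) ⟨
  toℚᵘ (divℕ 1 (suc b)) ℚᵘ.* toℚᵘ (divℕ 1 (suc b))      ≈⟨ toℚᵘ-homo-* (divℕ 1 (suc b)) (divℕ 1 (suc b)) ⟨
  toℚᵘ (divℕ 1 (suc b) * divℕ 1 (suc b))                ∎)
  where open ℚᵘP.≃-Reasoning

divℕ-pos : ∀ {n} → 0 ℕ.< n → 0ℚ < divℕ 1 n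
divℕ-pos {suc b} _ = positive⁻¹ (divℕ 1 (suc b)) {{normalize-pos 1 (suc b)}}

≤-by-difference : ∀ {x y d} → 0ℚ ≤ d → d ≡ y - x → x ≤ y
≤-by-difference {x} {y} 0≤d refl =
  subst₂ _≤_ (+-identityˡ x) (solve 2 (λ x y → (y :- x) :+ x := y) refl x y) (+-monoˡ-≤ x 0≤d)

<-by-difference : ∀ {x y d} → 0ℚ < d → d ≡ y - x → x < y
<-by-difference {x} {y} 0<d refl =
  subst₂ _<_ (+-identityˡ x) (solve 2 (λ x y → (y :- x) :+ x := y) refl x y) (+-monoˡ-< x 0<d)

difference-nonneg : ∀ {x y} → x ≤ y → 0ℚ ≤ y - x
difference-nonneg {x} {y} x≤y = subst (_≤ y - x) (+-inverseʳ x) (+-monoˡ-≤ (- x) x≤y)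

difference-pos : ∀ {x y} → x < y → 0ℚ < y - x
difference-pos {x} {y} x<y = subst (_< y - x) (+-inverseʳ x) (+-monoˡ-< (- x) x<y)

0≤* : ∀ {a b} → 0ℚ ≤ a → 0ℚ ≤ b → 0ℚ ≤ a * b
0≤* {a} {b} 0≤a 0≤b = nonNegative⁻¹ (a * b) {{nonNeg*nonNeg⇒nonNeg a {{nonNegative 0≤a}} b {{nonNegative 0≤b}}}}

0<* : ∀ {a b} → 0ℚ < a → 0ℚ < b → 0ℚ < a * b
0<* {a} {b} 0<a 0<b = positive⁻¹ (a * b) {{pos*pos⇒pos a {{positive 0<a}} b {{positive 0<b}}}}

scale-≤ : ∀ {r x y} → 0ℚ ≤ r → x ≤ y → r * x ≤ r * y
scale-≤ {r} 0≤r = *-monoˡ-≤-nonNeg r {{nonNegative 0≤r}}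

∣-∣-flip : ∀ x y → ∣ x - y ∣ ≡ ∣ y - x ∣
∣-∣-flip x y = trans (sym (∣-p∣≡∣p∣ (x - y))) (cong ∣_∣ (solve 2 (λ x y → :- (x :- y) := y :- x) refl x y))

1≤⇒1≤∣∣ : ∀ {x} → 1ℚ ≤ x → 1ℚ ≤ ∣ x ∣
1≤⇒1≤∣∣ 1≤x = subst (1ℚ ≤_) (sym (0≤p⇒∣p∣≡p (≤-trans (nonNegative⁻¹ 1ℚ) 1≤x))) 1≤x

square-abs : ∀ x → x * x ≡ ∣ x ∣ * ∣ x ∣
square-abs x with ∣p∣≡p∨∣p∣≡-p x
... | inj₁ ∣x∣≡x  = cong (λ m → m * m) (sym ∣x∣≡x)
... | inj₂ ∣x∣≡-x = trans (solve 1 (λ x → x :* x := (:- x) :* (:- x)) refl x) (cong (λ m → m * m) (sym ∣x∣≡-x))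

0≤square : ∀ x → 0ℚ ≤ x * x
0≤square x = subst (0ℚ ≤_) (sym (square-abs x)) (0≤* (0≤∣p∣ x) (0≤∣p∣ x))

square≤abs : ∀ {x} → ∣ x ∣ ≤ 1ℚ → x * x ≤ ∣ x ∣
square≤abs {x} ∣x∣≤1 = ≤-by-difference (0≤* (0≤∣p∣ x) (difference-nonneg ∣x∣≤1))
  (trans (solve 1 (λ m → m :* (con 1ℚ :- m) := m :- m :* m) refl ∣ x ∣)
         (cong (λ s → ∣ x ∣ - s) (sym (square-abs x))))

↑-nonneg : ∀ a → 0ℚ ≤ ↑ a
↑-nonneg zero    = ≤-refl
↑-nonneg (suc a) = subst (0ℚ ≤_) (sym (↑-+ 1 a)) (+-mono-≤ (nonNegative⁻¹ 1ℚ) (↑-nonneg a))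

↑-gap : ∀ {a b} → a ℕ.< b → 1ℚ ≤ ↑ b - ↑ a
↑-gap {a} a<b with ℕP.m≤n⇒∃[o]m+o≡n a<b
... | d , refl = ≤-by-difference (↑-nonneg d) (begin
  ↑ d                             ≡⟨ solve 2 (λ a d → d := (con 1ℚ :+ a :+ d) :- a :- con 1ℚ) refl (↑ a) (↑ d) ⟩
  (1ℚ + ↑ a + ↑ d) - ↑ a - 1ℚ     ≡⟨ cong (λ s → s - ↑ a - 1ℚ) (sym ↑-sum) ⟩
  ↑ (suc a ℕ.+ d) - ↑ a - 1ℚ      ∎)
  where
  open ≡-Reasoning
  ↑-sum : ↑ (suc a ℕ.+ d) ≡ 1ℚ + ↑ a + ↑ d
  ↑-sum = trans (↑-+ (suc a) d) (cong (_+ ↑ d) (↑-+ 1 a))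

unit-gap : ∀ {a b} → a ≢ b → 1ℚ ≤ ∣ ↑ a - ↑ b ∣
unit-gap {a} {b} a≢b with ℕP.<-cmp a b
... | tri< a<b _ _ = subst (1ℚ ≤_) (∣-∣-flip (↑ b) (↑ a)) (1≤⇒1≤∣∣ (↑-gap a<b))
... | tri≈ _ a≡b _ = ⊥-elim (a≢b a≡b)
... | tri> _ _ b<a = 1≤⇒1≤∣∣ (↑-gap b<a)

1≤↑ : ∀ {n} → 0 ℕ.< n → 1ℚ ≤ ↑ n
1≤↑ {n} 0<n = subst (1ℚ ≤_) (+-identityʳ (↑ n)) (↑-gap 0<n)

divℕ≤1 : ∀ {n} → 0 ℕ.< n → divℕ 1 n ≤ 1ℚ
divℕ≤1 {n} 0<n = begin
  r           ≡⟨ *-identityʳ r ⟨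
  r * 1ℚ      ≤⟨ scale-≤ (<⇒≤ (divℕ-pos 0<n)) (1≤↑ 0<n) ⟩
  r * ↑ n     ≡⟨ trans (*-comm r (↑ n)) (↑-inverse 0<n) ⟩
  1ℚ          ∎
  where
  open ≤-Reasoning
  r : ℚ
  r = divℕ 1 n

Σ-cong : ∀ {n} {F G : Fin n → ℚ} → (∀ i → F i ≡ G i) → Σℚ F ≡ Σℚ G
Σ-cong {zero}  F≡G = refl
Σ-cong {suc n} F≡G = cong₂ _+_ (F≡G zero) (Σ-cong (λ i → F≡G (suc i)))

Σ-drop-zero : ∀ {n} (F : Fin (suc n) → ℚ) → F zero ≡ 0ℚ → Σℚ F ≡ Σℚ (λ i → F (suc i))
Σ-drop-zero F F0≡0 = trans (cong (_+ Σℚ (λ i → F (suc i))) F0≡0) (+-identityˡ _)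

Σ-scale : ∀ {n} a (F : Fin n → ℚ) → Σℚ (λ i → a * F i) ≡ a * Σℚ F
Σ-scale {zero}  a F = sym (*-zeroʳ a)
Σ-scale {suc n} a F = trans (cong (_+_ (a * F zero)) (Σ-scale a (λ i → F (suc i)))) (sym (*-distribˡ-+ a _ _))

Σ-linear : ∀ {n} a b (F G : Fin n → ℚ) → Σℚ (λ i → a * F i + b * G i) ≡ a * Σℚ F + b * Σℚ G
Σ-linear {zero}  a b F G = solve 2 (λ a b → con 0ℚ := a :* con 0ℚ :+ b :* con 0ℚ) refl a b
Σ-linear {suc n} a b F G =
  trans (cong (_+_ (a * F zero + b * G zero)) (Σ-linear a b (λ i → F (suc i)) (λ i → G (suc i))))
        (solve 6 (λ a b x y X Y → a :* x :+ b :* y :+ (a :* X :+ b :* Y) := a :* (x :+ X) :+ b :* (y :+ Y))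
               refl a b (F zero) (G zero) (Σℚ (λ i → F (suc i))) (Σℚ (λ i → G (suc i))))

Σ-linear₃ : ∀ {n} a b c (F G H : Fin n → ℚ) →
  Σℚ (λ i → a * F i + b * G i + c * H i) ≡ a * Σℚ F + b * Σℚ G + c * Σℚ H
Σ-linear₃ {zero}  a b c F G H = solve 3 (λ a b c → con 0ℚ := a :* con 0ℚ :+ b :* con 0ℚ :+ c :* con 0ℚ) refl a b c
Σ-linear₃ {suc n} a b c F G H =
  trans (cong (_+_ (a * F zero + b * G zero + c * H zero))
              (Σ-linear₃ a b c (λ i → F (suc i)) (λ i → G (suc i)) (λ i → H (suc i))))
        (solve 9 (λ a b c x y z X Y Z → a :* x :+ b :* y :+ c :* z :+ (a :* X :+ b :* Y :+ c :* Z)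
                                        := a :* (x :+ X) :+ b :* (y :+ Y) :+ c :* (z :+ Z))
               refl a b c (F zero) (G zero) (H zero)
               (Σℚ (λ i → F (suc i))) (Σℚ (λ i → G (suc i))) (Σℚ (λ i → H (suc i))))

Σ-mono : ∀ {n} {F G : Fin n → ℚ} → (∀ i → F i ≤ G i) → Σℚ F ≤ Σℚ G
Σ-mono {zero}  F≤G = ≤-refl
Σ-mono {suc n} F≤G = +-mono-≤ (F≤G zero) (Σ-mono (λ i → F≤G (suc i)))

Σ-nonneg : ∀ {n} {F : Fin n → ℚ} → (∀ i → 0ℚ ≤ F i) → 0ℚ ≤ Σℚ F
Σ-nonneg {zero}  0≤F = ≤-refl
Σ-nonneg {suc n} 0≤F = +-mono-≤ (0≤F zero) (Σ-nonneg (λ i → 0≤F (suc i)))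

Σ-triangle : ∀ {n} (F : Fin n → ℚ) → ∣ Σℚ F ∣ ≤ Σℚ (λ i → ∣ F i ∣)
Σ-triangle {zero}  F = ≤-refl
Σ-triangle {suc n} F =
  ≤-trans (∣p+q∣≤∣p∣+∣q∣ (F zero) _) (+-monoʳ-≤ ∣ F zero ∣ (Σ-triangle (λ i → F (suc i))))

Σ-↑ : ∀ {n} (F : Fin n → ℕ) → Σℚ (λ i → ↑ (F i)) ≡ ↑ (Σℕ F)
Σ-↑ {zero}  F = refl
Σ-↑ {suc n} F = trans (cong (_+_ (↑ (F zero))) (Σ-↑ (λ i → F (suc i)))) (sym (↑-+ (F zero) _))

Var-translate : ∀ {n} (π f : Fin n → ℚ) a → Σℚ π ≡ 1ℚ → Var π (λ v → f v - a) ≡ Var π f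
Var-translate π f a Σπ≡1 = begin
  Var π (λ v → f v - a)
    ≡⟨ cong₂ (λ s t → s - t * t) second-moment first-moment ⟩
  (1ℚ * E₂ + (- (a + a)) * E₁ + (a * a) * 1ℚ) - (1ℚ * E₁ + (- a) * 1ℚ) * (1ℚ * E₁ + (- a) * 1ℚ)
    ≡⟨ solve 3 (λ a x y → (con 1ℚ :* y :+ (:- (a :+ a)) :* x :+ (a :* a) :* con 1ℚ)
                         :- (con 1ℚ :* x :+ (:- a) :* con 1ℚ) :* (con 1ℚ :* x :+ (:- a) :* con 1ℚ)
                         := y :- x :* x) refl a E₁ E₂ ⟩
  Var π f ∎
  where
  open ≡-Reasoning
  E₁ E₂ : ℚ
  E₁ = Σℚ (λ v → π v * f v)
  E₂ = Σℚ (λ v → π v * (f v * f v))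
  second-moment : Σℚ (λ v → π v * ((f v - a) * (f v - a))) ≡ 1ℚ * E₂ + (- (a + a)) * E₁ + (a * a) * 1ℚ
  second-moment = begin
    Σℚ (λ v → π v * ((f v - a) * (f v - a)))
      ≡⟨ Σ-cong (λ v → solve 3 (λ w x a → w :* ((x :- a) :* (x :- a))
                                         := con 1ℚ :* (w :* (x :* x)) :+ (:- (a :+ a)) :* (w :* x) :+ (a :* a) :* w)
                               refl (π v) (f v) a) ⟩
    Σℚ (λ v → 1ℚ * (π v * (f v * f v)) + (- (a + a)) * (π v * f v) + (a * a) * π v)
      ≡⟨ Σ-linear₃ 1ℚ (- (a + a)) (a * a) (λ v → π v * (f v * f v)) (λ v → π v * f v) π ⟩
    1ℚ * E₂ + (- (a + a)) * E₁ + (a * a) * Σℚ π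
      ≡⟨ cong (λ w → 1ℚ * E₂ + (- (a + a)) * E₁ + (a * a) * w) Σπ≡1 ⟩
    1ℚ * E₂ + (- (a + a)) * E₁ + (a * a) * 1ℚ ∎
  first-moment : Σℚ (λ v → π v * (f v - a)) ≡ 1ℚ * E₁ + (- a) * 1ℚ
  first-moment = begin
    Σℚ (λ v → π v * (f v - a))
      ≡⟨ Σ-cong (λ v → solve 3 (λ w x a → w :* (x :- a) := con 1ℚ :* (w :* x) :+ (:- a) :* w) refl (π v) (f v) a) ⟩
    Σℚ (λ v → 1ℚ * (π v * f v) + (- a) * π v)
      ≡⟨ Σ-linear 1ℚ (- a) (λ v → π v * f v) π ⟩
    1ℚ * E₁ + (- a) * Σℚ π
      ≡⟨ cong (λ w → 1ℚ * E₁ + (- a) * w) Σπ≡1 ⟩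
    1ℚ * E₁ + (- a) * 1ℚ ∎

side : ℚ → Bool
side x = does (0ℚ ≤? x)

signValue : Bool → ℚ
signValue true  = 1ℚ
signValue false = - 1ℚ

rounding-distance : ∀ x → ∣ x ∣ ≤ 1ℚ → ∣ x - signValue (side x) ∣ ≡ 1ℚ - ∣ x ∣
rounding-distance x ∣x∣≤1 = trans (distance (0ℚ ≤? x)) (0≤p⇒∣p∣≡p (difference-nonneg ∣x∣≤1))
  where
  distance : (d : Dec (0ℚ ≤ x)) → ∣ x - signValue (does d) ∣ ≡ ∣ 1ℚ - ∣ x ∣ ∣
  distance (yes 0≤x) = trans (∣-∣-flip x 1ℚ) (cong (λ m → ∣ 1ℚ - m ∣) (sym (0≤p⇒∣p∣≡p 0≤x)))
  distance (no 0≰x) with ∣p∣≡p∨∣p∣≡-p x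
  ... | inj₁ ∣x∣≡x  = ⊥-elim (0≰x (∣p∣≡p⇒0≤p ∣x∣≡x))
  ... | inj₂ ∣x∣≡-x = cong ∣_∣ (trans (solve 1 (λ x → x :- (:- con 1ℚ) := con 1ℚ :- (:- x)) refl x)
                                     (cong (_-_ 1ℚ) (sym ∣x∣≡-x)))

-- If |M| + T ≥ 1 then u T or (u M)² is large: for 0 ≤ u ≤ 1 and T ≥ 0,
-- u T + (u M)² ≥ u²/4  (split on T ≥ ½, otherwise |M| ≥ ½).
deficit-bound : ∀ {u T M} → 0ℚ ≤ u → u ≤ 1ℚ → 0ℚ ≤ T → 1ℚ ≤ ∣ M ∣ + T →
  u * u * (+ 1 / 4) ≤ u * T + (u * M) * (u * M)
deficit-bound {u} {T} {M} 0≤u u≤1 0≤T 1≤∣M∣+T with (+ 1 / 2) ≤? T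
... | yes ½≤T = ≤-by-difference
  (+-mono-≤ (+-mono-≤ (+-mono-≤ (0≤* 0≤u (difference-nonneg ½≤T))
                                (0≤* (0≤* 0≤u (difference-nonneg u≤1)) (nonNegative⁻¹ (+ 1 / 4))))
                      (0≤* 0≤u (nonNegative⁻¹ (+ 1 / 4))))
            (0≤square (u * M)))
  (solve 3 (λ u T M → u :* (T :- con (+ 1 / 2)) :+ u :* (con 1ℚ :- u) :* con (+ 1 / 4) :+ u :* con (+ 1 / 4)
                      :+ (u :* M) :* (u :* M)
                      := u :* T :+ (u :* M) :* (u :* M) :- u :* u :* con (+ 1 / 4)) refl u T M)
... | no ½≰T = ≤-by-difference
  (+-mono-≤ (0≤* 0≤u 0≤T) (0≤* (0≤* (0≤* 0≤u 0≤u) ∣M∣≥½) (+-mono-≤ (0≤∣p∣ M) (nonNegative⁻¹ (+ 1 / 2)))))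
  (trans (solve 3 (λ u T m → u :* T :+ u :* u :* (m :- con (+ 1 / 2)) :* (m :+ con (+ 1 / 2))
                             := u :* T :+ u :* u :* (m :* m) :- u :* u :* con (+ 1 / 4)) refl u T ∣ M ∣)
         (cong (λ s → u * T + s - u * u * (+ 1 / 4))
               (trans (cong (λ s → u * u * s) (sym (square-abs M)))
                      (solve 2 (λ u M → u :* u :* (M :* M) := (u :* M) :* (u :* M)) refl u M))))
  where
  ∣M∣≥½ : 0ℚ ≤ ∣ M ∣ - + 1 / 2
  ∣M∣≥½ = subst (0ℚ ≤_) (solve 2 (λ m T → (m :+ T :- con 1ℚ) :+ (con (+ 1 / 2) :- T) := m :- con (+ 1 / 2)) refl ∣ M ∣ T)
                (+-mono-≤ (difference-nonneg 1≤∣M∣+T) (<⇒≤ (difference-pos (≰⇒> ½≰T))))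

partSum : ∀ {n} → (Fin n → ℕ) → (Fin n → Bool) → Bool → ℕ
partSum p S b = Σℕ (λ i → inPart b (S i) (p i))

Balanced : ∀ {n} → (Fin n → ℕ) → (Fin n → Bool) → Set
Balanced p S = partSum p S true ≡ partSum p S false

signedSum : ∀ {n} → (Fin n → ℕ) → (Fin n → Bool) → ℚ
signedSum p S = Σℚ (λ i → ↑ (p i) * signValue (S i))

signedSum-parts : ∀ {n} (p : Fin n → ℕ) S → signedSum p S ≡ ↑ (partSum p S true) - ↑ (partSum p S false)
signedSum-parts p S = begin
  signedSum p S
    ≡⟨ Σ-cong (λ i → by-side (S i) (p i)) ⟩
  Σℚ (λ i → 1ℚ * ↑ (inPart true (S i) (p i)) + (- 1ℚ) * ↑ (inPart false (S i) (p i)))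
    ≡⟨ Σ-linear 1ℚ (- 1ℚ) (λ i → ↑ (inPart true (S i) (p i))) (λ i → ↑ (inPart false (S i) (p i))) ⟩
  1ℚ * Σℚ (λ i → ↑ (inPart true (S i) (p i))) + (- 1ℚ) * Σℚ (λ i → ↑ (inPart false (S i) (p i)))
    ≡⟨ cong₂ (λ A B → 1ℚ * A + (- 1ℚ) * B) (Σ-↑ (λ i → inPart true (S i) (p i))) (Σ-↑ (λ i → inPart false (S i) (p i))) ⟩
  1ℚ * ↑ (partSum p S true) + (- 1ℚ) * ↑ (partSum p S false)
    ≡⟨ solve 2 (λ A B → con 1ℚ :* A :+ con (- 1ℚ) :* B := A :- B) refl (↑ (partSum p S true)) (↑ (partSum p S false)) ⟩
  ↑ (partSum p S true) - ↑ (partSum p S false) ∎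
  where
  open ≡-Reasoning
  by-side : ∀ b x → ↑ x * signValue b ≡ 1ℚ * ↑ (inPart true b x) + (- 1ℚ) * ↑ (inPart false b x)
  by-side true  x = solve 1 (λ x → x :* con 1ℚ := con 1ℚ :* x :+ con (- 1ℚ) :* con 0ℚ) refl (↑ x)
  by-side false x = solve 1 (λ x → x :* con (- 1ℚ) := con 1ℚ :* con 0ℚ :+ con (- 1ℚ) :* x) refl (↑ x)

unbalanced-gap : ∀ {n} (p : Fin n → ℕ) S → ¬ Balanced p S → 1ℚ ≤ ∣ signedSum p S ∣
unbalanced-gap p S unbalanced = subst (λ z → 1ℚ ≤ ∣ z ∣) (sym (signedSum-parts p S)) (unit-gap unbalanced)

module Star (β : ℚ) (0<β : 0ℚ < β) (β≤1 : β ≤ 1ℚ)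
            {k : ℕ} (p : Fin (suc k) → ℕ) (0<P : 0 ℕ.< total p) where

  Vertex : Set
  Vertex = Fin (suc (suc k))

  P : ℕ
  P = total p

  u : ℚ
  u = β * divℕ 1 P

  π : Vertex → ℚ
  π = πstar β p

  q : Fin (suc k) → ℚ
  q i = u * ↑ (p i)

  0<u : 0ℚ < u
  0<u = 0<* 0<β (divℕ-pos 0<P)

  0≤u : 0ℚ ≤ u
  0≤u = <⇒≤ 0<u

  u≤1 : u ≤ 1ℚ
  u≤1 = begin
    β * divℕ 1 P    ≤⟨ *-monoʳ-≤-nonNeg (divℕ 1 P) {{nonNegative (<⇒≤ (divℕ-pos 0<P))}} β≤1 ⟩
    1ℚ * divℕ 1 P   ≡⟨ *-identityˡ (divℕ 1 P) ⟩
    divℕ 1 P        ≤⟨ divℕ≤1 0<P ⟩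
    1ℚ              ∎
    where open ≤-Reasoning

  π-leaf : ∀ i → π (suc i) ≡ q i
  π-leaf i = trans (cong (β *_) (↑-divℕ (p i) 0<P))
    (solve 3 (λ b n r → b :* (n :* r) := b :* r :* n) refl β (↑ (p i)) (divℕ 1 P))

  Σq : Σℚ q ≡ β
  Σq = begin
    Σℚ q                    ≡⟨ Σ-scale u (λ i → ↑ (p i)) ⟩
    u * Σℚ (λ i → ↑ (p i))  ≡⟨ cong (u *_) (Σ-↑ p) ⟩
    β * divℕ 1 P * ↑ P      ≡⟨ *-assoc β (divℕ 1 P) (↑ P) ⟩
    β * (divℕ 1 P * ↑ P)    ≡⟨ cong (β *_) (trans (*-comm (divℕ 1 P) (↑ P)) (↑-inverse 0<P)) ⟩
    β * 1ℚ                  ≡⟨ *-identityʳ β ⟩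
    β                       ∎
    where open ≡-Reasoning

  Σπ : Σℚ π ≡ 1ℚ
  Σπ = trans (cong (_+_ (1ℚ - β)) (trans (Σ-cong π-leaf) Σq)) (solve 1 (λ b → con 1ℚ :- b :+ b := con 1ℚ) refl β)

  rise : (Vertex → ℚ) → Fin (suc k) → ℚ
  rise f i = f (suc i) - f zero

  slack : (Vertex → ℚ) → ℚ
  slack f = Σℚ (λ i → ↑ (p i) * (1ℚ - ∣ rise f i ∣))

  net : (Vertex → ℚ) → ℚ
  net f = Σℚ (λ i → ↑ (p i) * rise f i)

  signs : (Vertex → ℚ) → Fin (suc k) → Bool
  signs f i = side (rise f i)

  Var-centred : ∀ f → Var π f ≡ Σℚ (λ i → q i * (rise f i * rise f i)) - (u * net f) * (u * net f)
  Var-centred f = trans (sym (Var-translate π f (f zero) Σπ)) (cong₂ (λ s t → s - t * t) second first)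
    where
    second : Σℚ (λ v → π v * ((f v - f zero) * (f v - f zero))) ≡ Σℚ (λ i → q i * (rise f i * rise f i))
    second = trans (Σ-drop-zero (λ v → π v * ((f v - f zero) * (f v - f zero)))
                                (solve 2 (λ b a → (con 1ℚ :- b) :* ((a :- a) :* (a :- a)) := con 0ℚ) refl β (f zero)))
                   (Σ-cong (λ i → cong (_* (rise f i * rise f i)) (π-leaf i)))
    first : Σℚ (λ v → π v * (f v - f zero)) ≡ u * net f
    first = trans (Σ-drop-zero (λ v → π v * (f v - f zero))
                               (solve 2 (λ b a → (con 1ℚ :- b) :* (a :- a) := con 0ℚ) refl β (f zero)))
                  (trans (Σ-cong (λ i → trans (cong (_* rise f i) (π-leaf i)) (*-assoc u (↑ (p i)) (rise f i))))
                         (Σ-scale u (λ i → ↑ (p i) * rise f i)))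

  module _ (f : Vertex → ℚ) (lipschitz : Lipschitz f) where

    rise-bounded : ∀ i → ∣ rise f i ∣ ≤ 1ℚ
    rise-bounded i = subst (_≤ 1ℚ) (∣-∣-flip (f zero) (f (suc i))) (lipschitz i)

    slack-nonneg : 0ℚ ≤ slack f
    slack-nonneg = Σ-nonneg (λ i → 0≤* (↑-nonneg (p i)) (difference-nonneg (rise-bounded i)))

    variance-bound : Var π f ≤ β - (u * slack f + (u * net f) * (u * net f))
    variance-bound = begin
      Var π f                                       ≡⟨ Var-centred f ⟩
      Σℚ (λ i → q i * (g i * g i)) - H²             ≤⟨ +-monoˡ-≤ (- H²) (Σ-mono square≤abs-weighted) ⟩
      Σℚ (λ i → q i * ∣ g i ∣) - H²                 ≡⟨ cong (_- H²) absolute-moment ⟩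
      β - u * slack f - H²                          ≡⟨ solve 3 (λ b t h → b :- t :- h := b :- (t :+ h)) refl β (u * slack f) H² ⟩
      β - (u * slack f + H²)                        ∎
      where
      open ≤-Reasoning
      g : Fin (suc k) → ℚ
      g = rise f
      H² : ℚ
      H² = (u * net f) * (u * net f)
      square≤abs-weighted : ∀ i → q i * (g i * g i) ≤ q i * ∣ g i ∣
      square≤abs-weighted i = scale-≤ (0≤* 0≤u (↑-nonneg (p i))) (square≤abs (rise-bounded i))
      absolute-moment : Σℚ (λ i → q i * ∣ g i ∣) ≡ β - u * slack f
      absolute-moment = trans
        (Σ-cong (λ i → solve 3 (λ u n m → u :* n :* m := con 1ℚ :* (u :* n) :+ (:- u) :* (n :* (con 1ℚ :- m))) refl u (↑ (p i)) ∣ g i ∣))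
        (trans (Σ-linear 1ℚ (- u) q (λ i → ↑ (p i) * (1ℚ - ∣ g i ∣)))
               (trans (cong (λ s → 1ℚ * s + (- u) * slack f) Σq)
                      (solve 3 (λ b u t → con 1ℚ :* b :+ (:- u) :* t := b :- u :* t) refl β u (slack f))))

    variance≤β : Var π f ≤ β
    variance≤β = ≤-trans variance-bound
      (≤-by-difference (+-mono-≤ (0≤* 0≤u slack-nonneg) (0≤square (u * net f)))
        (solve 2 (λ b d → d := b :- (b :- d)) refl β (u * slack f + (u * net f) * (u * net f))))

    rounding-error : ∣ net f - signedSum p (signs f) ∣ ≤ slack f
    rounding-error = begin
      ∣ net f - signedSum p (signs f) ∣              ≡⟨ cong ∣_∣ net-difference ⟩
      ∣ Σℚ (λ i → ↑ (p i) * (g i - s i)) ∣          ≤⟨ Σ-triangle (λ i → ↑ (p i) * (g i - s i)) ⟩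
      Σℚ (λ i → ∣ ↑ (p i) * (g i - s i) ∣)          ≡⟨ Σ-cong termwise ⟩
      slack f                                        ∎
      where
      open ≤-Reasoning
      g s : Fin (suc k) → ℚ
      g = rise f
      s i = signValue (signs f i)
      net-difference : net f - signedSum p (signs f) ≡ Σℚ (λ i → ↑ (p i) * (g i - s i))
      net-difference = sym (trans
        (Σ-cong (λ i → solve 3 (λ n x y → n :* (x :- y) := con 1ℚ :* (n :* x) :+ con (- 1ℚ) :* (n :* y)) refl (↑ (p i)) (g i) (s i)))
        (trans (Σ-linear 1ℚ (- 1ℚ) (λ i → ↑ (p i) * g i) (λ i → ↑ (p i) * s i))
               (solve 2 (λ x y → con 1ℚ :* x :+ con (- 1ℚ) :* y := x :- y) refl (net f) (signedSum p (signs f)))))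
      termwise : ∀ i → ∣ ↑ (p i) * (g i - s i) ∣ ≡ ↑ (p i) * (1ℚ - ∣ g i ∣)
      termwise i = trans (∣p*q∣≡∣p∣*∣q∣ (↑ (p i)) (g i - s i))
        (cong₂ _*_ (0≤p⇒∣p∣≡p (↑-nonneg (p i))) (rounding-distance (g i) (rise-bounded i)))

    net-or-slack : ¬ Balanced p (signs f) → 1ℚ ≤ ∣ net f ∣ + slack f
    net-or-slack unbalanced = begin
      1ℚ                                  ≤⟨ unbalanced-gap p (signs f) unbalanced ⟩
      ∣ Z ∣                               ≡⟨ cong ∣_∣ (solve 2 (λ m z → z := m :- (m :- z)) refl (net f) Z) ⟩
      ∣ net f - (net f - Z) ∣             ≤⟨ ∣p-q∣≤∣p∣+∣q∣ (net f) (net f - Z) ⟩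
      ∣ net f ∣ + ∣ net f - Z ∣           ≤⟨ +-monoʳ-≤ ∣ net f ∣ rounding-error ⟩
      ∣ net f ∣ + slack f                 ∎
      where
      open ≤-Reasoning
      Z : ℚ
      Z = signedSum p (signs f)

  δ : ℚ
  δ = u * u * (+ 1 / 8)

  0<δ : 0ℚ < δ
  0<δ = 0<* (0<* 0<u 0<u) (positive⁻¹ (+ 1 / 8))

  δ-scaling : β * β * (+ 1 / 8) * divℕ 1 (P ℕ.* P) ≡ δ
  δ-scaling = trans (cong (_*_ (β * β * (+ 1 / 8))) (divℕ-square 0<P))
    (solve 3 (λ b r e → b :* b :* e :* (r :* r) := b :* r :* (b :* r) :* e) refl β (divℕ 1 P) (+ 1 / 8))

  unbalanced-variance : ∀ f → Lipschitz f → ¬ Balanced p (signs f) → Var π f + δ ≤ β - δ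
  unbalanced-variance f lipschitz unbalanced = begin
    Var π f + δ             ≤⟨ +-monoˡ-≤ δ (variance-bound f lipschitz) ⟩
    β - D + δ               ≤⟨ +-monoˡ-≤ δ (+-monoʳ-≤ β (neg-antimono-≤ large-deficit)) ⟩
    β - u * u * (+ 1 / 4) + δ ≡⟨ quarter-minus-eighth ⟩
    β - δ                   ∎
    where
    open ≤-Reasoning
    D : ℚ
    D = u * slack f + (u * net f) * (u * net f)
    large-deficit : u * u * (+ 1 / 4) ≤ D
    large-deficit = deficit-bound 0≤u u≤1 (slack-nonneg f lipschitz) (net-or-slack f lipschitz unbalanced)
    quarter-minus-eighth : β - u * u * (+ 1 / 4) + δ ≡ β - δ
    quarter-minus-eighth = solve 2 (λ b u → b :- u :* u :* con (+ 1 / 4) :+ u :* u :* con (+ 1 / 8)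
                                            := b :- u :* u :* con (+ 1 / 8)) refl β u

  signFunction : (Fin (suc k) → Bool) → Vertex → ℚ
  signFunction S zero    = 0ℚ
  signFunction S (suc i) = signValue (S i)

  signFunction-lipschitz : ∀ S → Lipschitz (signFunction S)
  signFunction-lipschitz S i = unit-step (S i)
    where
    unit-step : ∀ b → ∣ 0ℚ - signValue b ∣ ≤ 1ℚ
    unit-step true  = ≤-refl
    unit-step false = ≤-refl

  balanced-variance : ∀ S → Balanced p S → Var π (signFunction S) ≡ β
  balanced-variance S balanced = begin
    Var π (signFunction S)
      ≡⟨ Var-centred (signFunction S) ⟩
    Σℚ (λ i → q i * (rise f₀ i * rise f₀ i)) - (u * net f₀) * (u * net f₀)
      ≡⟨ cong₂ (λ a m → a - (u * m) * (u * m)) (trans (Σ-cong (λ i → unit-square (S i) (q i))) Σq) zero-net ⟩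
    β - (u * 0ℚ) * (u * 0ℚ)
      ≡⟨ solve 2 (λ b u → b :- (u :* con 0ℚ) :* (u :* con 0ℚ) := b) refl β u ⟩
    β ∎
    where
    open ≡-Reasoning
    f₀ : Vertex → ℚ
    f₀ = signFunction S
    unit-square : ∀ b w → w * ((signValue b - 0ℚ) * (signValue b - 0ℚ)) ≡ w
    unit-square true  w = *-identityʳ w
    unit-square false w = *-identityʳ w
    unit-rise : ∀ b n → n * (signValue b - 0ℚ) ≡ n * signValue b
    unit-rise true  n = refl
    unit-rise false n = refl
    zero-net : net f₀ ≡ 0ℚ
    zero-net = trans (Σ-cong (λ i → unit-rise (S i) (↑ (p i))))
      (trans (signedSum-parts p S)
             (trans (cong (λ B → ↑ (partSum p S true) - ↑ B) (sym balanced)) (+-inverseʳ (↑ (partSum p S true)))))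

  partition⇒sup≡β : Partitionable p → CEq π β
  partition⇒sup≡β (S , balanced) = variance≤β , λ ε 0<ε →
    signFunction S , signFunction-lipschitz S ,
    subst (β - ε <_) (sym (balanced-variance S balanced))
          (<-by-difference 0<ε (solve 2 (λ b e → e := b :- (b :- e)) refl β ε))

  sup≡β⇒partition : CEq π β → Partitionable p
  sup≡β⇒partition (_ , approximations) with approximations δ 0<δ
  ... | f , lipschitz , β-δ<Var with partSum p (signs f) true ℕ.≟ partSum p (signs f) false
  ...   | yes balanced   = signs f , balanced
  ...   | no  unbalanced = ⊥-elim (<-irrefl refl (begin-strict
    β - δ          <⟨ β-δ<Var ⟩
    Var π f        ≤⟨ ≤-by-difference (<⇒≤ 0<δ) (solve 2 (λ v d → d := v :+ d :- v) refl (Var π f) δ) ⟩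
    Var π f + δ    ≤⟨ unbalanced-variance f lipschitz unbalanced ⟩
    β - δ          ∎))
    where open ≤-Reasoning

  no-partition⇒gap : ¬ Partitionable p → CLt π (β - β * β * (+ 1 / 8) * divℕ 1 (P ℕ.* P))
  no-partition⇒gap no-partition = δ , 0<δ , λ f lipschitz →
    subst (λ c → Var π f + δ ≤ β - c) (sym δ-scaling)
          (unbalanced-variance f lipschitz (λ balanced → no-partition (signs f , balanced)))

total-pos : ∀ {k} (p : Fin (suc k) → ℕ) → ((i : Fin (suc k)) → 0 ℕ.< p i) → 0 ℕ.< total p
total-pos p p>0 = ℕP.<-≤-trans (p>0 zero) (ℕP.m≤m+n _ _)

mainTheorem17 : (β : ℚ) → 0ℚ < β → β < 1ℚ →
    Σ ℚ λ c → 0ℚ < c ×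
      ((k : ℕ) (p : Fin (suc k) → ℕ) → ((i : Fin (suc k)) → 0 Data.Nat.< p i) →
        ((Partitionable p → CEq (πstar β p) β) × (CEq (πstar β p) β → Partitionable p))
        × (¬ Partitionable p →
            CLt (πstar β p) (β - c * divℕ 1 (total p Data.Nat.* total p))))
mainTheorem17 β 0<β β<1 = β * β * (+ 1 / 8) , 0<* (0<* 0<β 0<β) (positive⁻¹ (+ 1 / 8)) ,
  λ k p p>0 → let open Star β 0<β (<⇒≤ β<1) p (total-pos p p>0)
              in (partition⇒sup≡β , sup≡β⇒partition) , no-partition⇒gap
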